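{- Let $\mathcal G=(V,\mathcal E)$ be a connected graph (loops allowed). Suppose there are distinct $i,j\in V$ with $e=\{i,j\}\notin\mathcal E$ and $\operatorname{ess}(f_{\mathcal G})_{i=j}=\operatorname{ess} f_{\mathcal G}-1$. Then there are distinct $i',j'\in V$ with $\{i',j'\}\in\mathcal E$ and $\operatorname{ess}(f_{\mathcal G})_{i'=j'}=\operatorname{ess} f_{\mathcal G}-1$.
   Context: A graph $\mathcal G=(V,\mathcal E)$ has finite vertex set $V=\{1,\dots,n\}$ and $\mathcal E\subseteq[V]^2\cup[V]^1$ (singletons are loops); connectivity refers to paths using 2-element edges. $f_{\mathcal G}\colon\{0,1\}^n\to\{0,1\}$ is computed by the $GF(2)$ polynomial $\sum_{E\in\mathcal E}\prod_{i\in E}x_i$. For a Boolean function $f$ of arity $n$, $f_{i=j}(a_1,\dots,a_n)=f(a_1,\dots,a_{i-1},a_j,a_{i+1},\dots,a_n)$ (identification of $x_i$ with $x_j$), and $\operatorname{ess} f$ is the number of variables $x_k$ on which $f$ essentially depends (for some values of the other arguments, varying $x_k$ changes the value). -}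

module Defs where

open import Data.Nat using (ℕ; zero; suc)
open import Data.Bool using (Bool; true; false; _∧_; _xor_; not; if_then_else_)
open import Data.Fin using (Fin; toℕ)
open import Data.Fin.Properties using (_≟_)
open import Data.Nat using (_<ᵇ_)
open import Data.List using (List; []; _∷_; foldr; map; concatMap; length; filter; allFin)
open import Relation.Nullary using (does)
open import Relation.Binary.PropositionalEquality using (_≡_)

-- A graph on V = Fin n: a symmetric, irreflexive adjacency relation (the
-- 2-element edges {i,j}) given by its characteristic function, plus the set
-- of loops (1-element edges {i}) given by its characteristic function.
record Graph (n : ℕ) : Set where
  field
    adj     : Fin n → Fin n → Bool
    loop    : Fin n → Bool
    adj-sym : ∀ i j → adj i j ≡ adj j i
    adj-irr : ∀ i → adj i i ≡ false
open Graph public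

data Reach {n : ℕ} (G : Graph n) : Fin n → Fin n → Set where
  here : ∀ {u} → Reach G u u
  step : ∀ {u v w} → adj G u v ≡ true → Reach G v w → Reach G u w

Connected : ∀ {n} → Graph n → Set
Connected {n} G = ∀ (u v : Fin n) → Reach G u v

BoolFun : ℕ → Set
BoolFun n = (Fin n → Bool) → Bool

xorSum : List Bool → Bool
xorSum = foldr _xor_ false

set : ∀ {n} → (Fin n → Bool) → Fin n → Bool → (Fin n → Bool)
set a k b m = if does (m ≟ k) then b else a m

-- f_G(x) = Σ_{{i,j} ∈ E, i<j} x_i x_j  +  Σ_{{i} ∈ E} x_i   over GF(2)
fG : ∀ {n} → Graph n → BoolFun n
fG {n} G x =
  xorSum (concatMap (λ i → map (λ j → (toℕ i <ᵇ toℕ j) ∧ adj G i j ∧ x i ∧ x j) (allFin n)) (allFin n))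
  xor xorSum (map (λ i → loop G i ∧ x i) (allFin n))

identify : ∀ {n} → BoolFun n → Fin n → Fin n → BoolFun n
identify f i j a = f (set a i (a j))

allAssign : (n : ℕ) → List (Fin n → Bool)
allAssign zero = (λ ()) ∷ []
allAssign (suc n) = concatMap (λ a → ext false a ∷ ext true a ∷ []) (allAssign n)
  where
  ext : Bool → (Fin n → Bool) → Fin (suc n) → Bool
  ext b a Fin.zero = b
  ext b a (Fin.suc m) = a m

anyB : ∀ {A : Set} → (A → Bool) → List A → Bool
anyB p = foldr (λ x r → p x Data.Bool.∨ r) false

essentialB : ∀ {n} → BoolFun n → Fin n → Bool
essentialB {n} f k = anyB (λ a → f a xor f (set a k (not (a k)))) (allAssign n)

ess : ∀ {n} → BoolFun n → ℕ
ess {n} f = length (filter (λ k → essentialB f k Data.Bool.≟ true) (allFin n))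

-- Over GF(2), flipping x_k changes f_G by loop(k) + Σ_{m ~ k} x_m. Hence in a connected graph with at
-- least two vertices every variable of f_G is essential, and after identifying x_i with x_j the
-- variable x_i disappears while every x_k with k ∉ {i, j} stays essential unless k is a loopless
-- vertex whose only neighbours are i and j (a satellite of {i, j}); for an edge {i, j}, x_j stays
-- essential unless i and j have opposite loop bits and the same other neighbours (opposite twins).
-- So ess drops by exactly one along every unobstructed edge. If every edge were obstructed, the
-- graph would be complete: a satellite forces the graph to be a triangle, and if every edge joins
-- opposite twins, a vertex with two neighbours would give three pairwise adjacent vertices with
-- pairwise distinct loop bits, so the graph is a single edge.
module Submission where

open import Defs
open import Algebra.Bundles using (CommutativeRing)
open import Data.Bool using (Bool; true; false; not; _∧_; _xor_; if_then_else_)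
import Data.Bool as Bool
open import Data.Bool.Properties
  using ( xor-∧-commutativeRing; xor-assoc; xor-same; xor-identityʳ; xor-comm; true-xor; xor-inverseˡ
        ; ¬-not; not-injective; if-eta; ∧-assoc; ∧-comm; ∧-zeroʳ; ∧-distribˡ-xor; ∧-distribʳ-xor; ∨-zeroʳ)
open import Data.Empty using (⊥; ⊥-elim)
open import Data.Fin using (Fin; zero; suc; toℕ)
open import Data.Fin.Properties using (_≟_; suc-injective; toℕ-injective; any?; all?)
open import Data.List using (List; []; _∷_; _++_; concat; concatMap; filter; length; map; tabulate; allFin)
open import Data.List.Properties using (map-tabulate; map-∘)
open import Data.List.Relation.Unary.Any using (Any; here; there)
import Data.List.Relation.Unary.Any as Any
open import Data.List.Relation.Unary.Any.Properties using (concatMap⁺)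
open import Data.Nat using (ℕ; zero; suc; _<ᵇ_)
open import Function using (_∘_; id)
open import Relation.Binary.PropositionalEquality
  using (_≡_; _≢_; _≗_; refl; sym; trans; cong; cong₂; module ≡-Reasoning)
open import Data.Product using (Σ; _×_; _,_; proj₁; proj₂; ∃-syntax)
open import Data.Sum using (_⊎_; inj₁; inj₂)
open import Relation.Nullary using (¬_; Dec; does; yes; no)
open import Relation.Nullary.Decidable
  using (¬?; _×-dec_; _⊎-dec_; _→-dec_; decidable-stable; dec-true; dec-false)

open import Algebra.Properties.CommutativeSemigroup
  (CommutativeRing.+-commutativeSemigroup xor-∧-commutativeRing)
  using () renaming (interchange to xor-interchange)
open import Algebra.Solver.CommutativeMonoid (CommutativeRing.+-commutativeMonoid xor-∧-commutativeRing)
  using (solve; _⊕_; _⊜_)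
open import Algebra.Properties.Semiring.Sum (CommutativeRing.semiring xor-∧-commutativeRing)
  using (sum; sum-syntax; sum-cong-≗; ∑-distrib-+; *-distribˡ-sum)

true≢false : true ≢ false
true≢false ()

no-three-distinct-bools : ∀ {u v w : Bool} → u ≢ v → u ≢ w → v ≢ w → ⊥
no-three-distinct-bools u≢v u≢w v≢w = v≢w (not-injective (trans (sym (¬-not u≢v)) (¬-not u≢w)))

xor-cancelˡ : ∀ x y → x xor (x xor y) ≡ y
xor-cancelˡ x y = trans (sym (xor-assoc x x y)) (cong (_xor y) (xor-same x))

xor-telescope : ∀ x y z → x xor z ≡ (x xor y) xor (y xor z)
xor-telescope x y z = trans (cong (x xor_) (sym (xor-cancelˡ y z))) (sym (xor-assoc x y (y xor z)))

<ᵇ-xor->ᵇ : ∀ {a b} → a ≢ b → (a <ᵇ b) xor (b <ᵇ a) ≡ true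
<ᵇ-xor->ᵇ {zero}  {zero}  a≢b = ⊥-elim (a≢b refl)
<ᵇ-xor->ᵇ {zero}  {suc b} a≢b = refl
<ᵇ-xor->ᵇ {suc a} {zero}  a≢b = refl
<ᵇ-xor->ᵇ {suc a} {suc b} a≢b = <ᵇ-xor->ᵇ (a≢b ∘ cong suc)

xor-≢ : ∀ {x y} → x ≢ y → x xor y ≡ true
xor-≢ {x} {y} x≢y = trans (cong (_xor y) (¬-not x≢y)) (xor-inverseˡ y)

-- Sums over GF(2)

xorSum-tabulate : ∀ {n} (h : Fin n → Bool) → xorSum (tabulate h) ≡ sum h
xorSum-tabulate {zero}  h = refl
xorSum-tabulate {suc n} h = cong (h zero xor_) (xorSum-tabulate (h ∘ suc))

xorSum-allFin : ∀ {n} (h : Fin n → Bool) → xorSum (map h (allFin n)) ≡ sum h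
xorSum-allFin h = trans (cong xorSum (map-tabulate id h)) (xorSum-tabulate h)

xorSum-++ : ∀ xs ys → xorSum (xs ++ ys) ≡ xorSum xs xor xorSum ys
xorSum-++ []       ys = refl
xorSum-++ (x ∷ xs) ys = trans (cong (x xor_) (xorSum-++ xs ys)) (sym (xor-assoc x _ _))

xorSum-concat : ∀ xss → xorSum (concat xss) ≡ xorSum (map xorSum xss)
xorSum-concat []         = refl
xorSum-concat (xs ∷ xss) = trans (xorSum-++ xs (concat xss)) (cong (xorSum xs xor_) (xorSum-concat xss))

∑-false : ∀ n → ∑[ m < n ] false ≡ false
∑-false zero    = refl
∑-false (suc n) = ∑-false n

δ : ∀ {n} → Fin n → Fin n → Bool
δ k m = does (m ≟ k)

δ-self : ∀ {n} (k : Fin n) → δ k k ≡ true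
δ-self k = dec-true (k ≟ k) refl

δ-other : ∀ {n} {k m : Fin n} → m ≢ k → δ k m ≡ false
δ-other {k = k} {m} = dec-false (m ≟ k)

∑-δˡ : ∀ {n} (k : Fin n) (h : Fin n → Bool) → ∑[ m < n ] (δ k m ∧ h m) ≡ h k
∑-δˡ {suc n} zero    h = trans (cong (h zero xor_) (∑-false n)) (xor-identityʳ (h zero))
∑-δˡ {suc n} (suc k) h = ∑-δˡ k (h ∘ suc)

∑-δʳ : ∀ {n} (k : Fin n) (h : Fin n → Bool) → ∑[ m < n ] (h m ∧ δ k m) ≡ h k
∑-δʳ k h = trans (sum-cong-≗ (λ m → ∧-comm (h m) (δ k m))) (∑-δˡ k h)

quad : ∀ {n} → (Fin n → Fin n → Bool) → (Fin n → Bool) → Bool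
quad {n} c x = ∑[ i < n ] ∑[ j < n ] (c i j ∧ (x i ∧ x j))

lin : ∀ {n} → (Fin n → Bool) → (Fin n → Bool) → Bool
lin {n} l x = ∑[ i < n ] (l i ∧ x i)

_⊕δ_ : ∀ {n} → (Fin n → Bool) → Fin n → Fin n → Bool
(x ⊕δ k) m = x m xor δ k m

lin-cong : ∀ {n} (l : Fin n → Bool) {x y} → x ≗ y → lin l x ≡ lin l y
lin-cong l x≗y = sum-cong-≗ (λ m → cong (l m ∧_) (x≗y m))

quad-cong : ∀ {n} (c : Fin n → Fin n → Bool) {x y} → x ≗ y → quad c x ≡ quad c y
quad-cong c x≗y = sum-cong-≗ (λ i → sum-cong-≗ (λ j → cong₂ (λ u v → c i j ∧ (u ∧ v)) (x≗y i) (x≗y j)))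

lin-false : ∀ {n} (l : Fin n → Bool) → lin l (λ _ → false) ≡ false
lin-false {n} l = trans (sum-cong-≗ (λ m → ∧-zeroʳ (l m))) (∑-false n)

lin-δ : ∀ {n} (l : Fin n → Bool) k → lin l (δ k) ≡ l k
lin-δ l k = ∑-δʳ k l

lin-xorˡ : ∀ {n} (l l′ x : Fin n → Bool) → lin (λ m → l m xor l′ m) x ≡ lin l x xor lin l′ x
lin-xorˡ l l′ x = trans (sum-cong-≗ (λ m → ∧-distribʳ-xor (x m) (l m) (l′ m)))
                         (∑-distrib-+ (λ m → l m ∧ x m) (λ m → l′ m ∧ x m))

lin-⊕δ : ∀ {n} (l x : Fin n → Bool) k → lin l (x ⊕δ k) ≡ lin l x xor l k
lin-⊕δ l x k = begin
  ∑[ m < _ ] (l m ∧ (x m xor δ k m))       ≡⟨ sum-cong-≗ (λ m → ∧-distribˡ-xor (l m) (x m) (δ k m)) ⟩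
  ∑[ m < _ ] (l m ∧ x m xor l m ∧ δ k m)   ≡⟨ ∑-distrib-+ (λ m → l m ∧ x m) (λ m → l m ∧ δ k m) ⟩
  lin l x xor ∑[ m < _ ] (l m ∧ δ k m)     ≡⟨ cong (lin l x xor_) (∑-δʳ k l) ⟩
  lin l x xor l k                          ∎
  where open ≡-Reasoning

quad-term-∂ : ∀ c xi di xj dj →
  c ∧ (xi ∧ xj) xor c ∧ ((xi xor di) ∧ (xj xor dj)) ≡ (c ∧ xi) ∧ dj xor di ∧ (c ∧ (xj xor dj))
quad-term-∂ false xi    false xj    dj    = refl
quad-term-∂ false xi    true  xj    dj    = refl
quad-term-∂ true  false false xj    dj    = refl
quad-term-∂ true  false true  xj    dj    = refl
quad-term-∂ true  true  false xj    dj    = trans (xor-cancelˡ xj dj) (sym (xor-identityʳ dj))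
quad-term-∂ true  true  true  false false = refl
quad-term-∂ true  true  true  false true  = refl
quad-term-∂ true  true  true  true  false = refl
quad-term-∂ true  true  true  true  true  = refl

∂-quad : ∀ {n} (c : Fin n → Fin n → Bool) x k →
  quad c x xor quad c (x ⊕δ k) ≡ lin (λ m → c m k xor c k m) x xor c k k
∂-quad {n} c x k = begin
  quad c x xor quad c x′
    ≡⟨ ∑-distrib-+ (λ i → ∑[ j < n ] (c i j ∧ (x i ∧ x j)))
                   (λ i → ∑[ j < n ] (c i j ∧ (x′ i ∧ x′ j))) ⟨
  ∑[ i < n ] (∑[ j < n ] (c i j ∧ (x i ∧ x j)) xor ∑[ j < n ] (c i j ∧ (x′ i ∧ x′ j)))
    ≡⟨ sum-cong-≗ row-∂ ⟩
  ∑[ i < n ] (c i k ∧ x i xor δ k i ∧ lin (c i) x′)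
    ≡⟨ ∑-distrib-+ (λ i → c i k ∧ x i) (λ i → δ k i ∧ lin (c i) x′) ⟩
  lin column x xor ∑[ i < n ] (δ k i ∧ lin (c i) x′)
    ≡⟨ cong (lin column x xor_) (∑-δˡ k (λ i → lin (c i) x′)) ⟩
  lin column x xor lin (c k) x′
    ≡⟨ cong (lin column x xor_) (lin-⊕δ (c k) x k) ⟩
  lin column x xor (lin (c k) x xor c k k)
    ≡⟨ xor-assoc (lin column x) (lin (c k) x) (c k k) ⟨
  (lin column x xor lin (c k) x) xor c k k
    ≡⟨ cong (_xor c k k) (lin-xorˡ column (c k) x) ⟨
  lin (λ m → c m k xor c k m) x xor c k k
    ∎
  where
  open ≡-Reasoning
  x′ = x ⊕δ k
  column = λ i → c i k
  row-∂ : ∀ i → ∑[ j < n ] (c i j ∧ (x i ∧ x j)) xor ∑[ j < n ] (c i j ∧ (x′ i ∧ x′ j))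
              ≡ c i k ∧ x i xor δ k i ∧ lin (c i) x′
  row-∂ i = begin
    ∑[ j < n ] (c i j ∧ (x i ∧ x j)) xor ∑[ j < n ] (c i j ∧ (x′ i ∧ x′ j))
      ≡⟨ ∑-distrib-+ (λ j → c i j ∧ (x i ∧ x j)) (λ j → c i j ∧ (x′ i ∧ x′ j)) ⟨
    ∑[ j < n ] (c i j ∧ (x i ∧ x j) xor c i j ∧ (x′ i ∧ x′ j))
      ≡⟨ sum-cong-≗ (λ j → quad-term-∂ (c i j) (x i) (δ k i) (x j) (δ k j)) ⟩
    ∑[ j < n ] ((c i j ∧ x i) ∧ δ k j xor δ k i ∧ (c i j ∧ x′ j))
      ≡⟨ ∑-distrib-+ (λ j → (c i j ∧ x i) ∧ δ k j) (λ j → δ k i ∧ (c i j ∧ x′ j)) ⟩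
    ∑[ j < n ] ((c i j ∧ x i) ∧ δ k j) xor ∑[ j < n ] (δ k i ∧ (c i j ∧ x′ j))
      ≡⟨ cong₂ _xor_ (∑-δʳ k (λ j → c i j ∧ x i))
                     (sym (*-distribˡ-sum (δ k i) (λ j → c i j ∧ x′ j))) ⟩
    c i k ∧ x i xor δ k i ∧ lin (c i) x′
      ∎

-- Essential variables

set-here : ∀ {n} (a : Fin n → Bool) k v → set a k v k ≡ v
set-here a k v = cong (λ b → if b then v else a k) (δ-self k)

set-there : ∀ {n} (a : Fin n → Bool) {k m} v → m ≢ k → set a k v m ≡ a m
set-there a {k} {m} v m≢k = cong (λ b → if b then v else a m) (δ-other m≢k)

toggle : ∀ {n} → (Fin n → Bool) → Fin n → Fin n → Bool
toggle a k = set a k (not (a k))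

toggle-⊕δ : ∀ {n} (a : Fin n → Bool) k → toggle a k ≗ a ⊕δ k
toggle-⊕δ a k m with m ≟ k
... | yes refl = sym (trans (xor-comm (a m) true) (true-xor (a m)))
... | no _     = sym (xor-identityʳ (a m))

Extensional : ∀ {n} → BoolFun n → Set
Extensional f = ∀ {a b} → a ≗ b → f a ≡ f b

∂ : ∀ {n} → BoolFun n → Fin n → (Fin n → Bool) → Bool
∂ f k a = f a xor f (toggle a k)

toggle-cong : ∀ {n} {a b : Fin n → Bool} k → a ≗ b → toggle a k ≗ toggle b k
toggle-cong k a≗b m = cong₂ (λ u v → if does (m ≟ k) then u else v) (cong not (a≗b k)) (a≗b m)

allAssign-complete : ∀ n (a : Fin n → Bool) → Any (_≗ a) (allAssign n)
allAssign-complete zero    a = here (λ ())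
allAssign-complete (suc n) a = concatMap⁺ _ (Any.map extend (allAssign-complete n (a ∘ suc)))
  where
  extend : ∀ {b} → b ≗ a ∘ suc → Any (_≗ a) _
  extend b≗ with a zero in a₀
  ... | false = here λ { zero → sym a₀ ; (suc m) → b≗ m }
  ... | true  = there (here λ { zero → sym a₀ ; (suc m) → b≗ m })

anyB-true : ∀ {A : Set} (p : A → Bool) {xs} → Any (λ x → p x ≡ true) xs → anyB p xs ≡ true
anyB-true p (here px)  rewrite px = refl
anyB-true p {x ∷ _} (there any) rewrite anyB-true p any = ∨-zeroʳ (p x)

anyB-false : ∀ {A : Set} (p : A → Bool) xs → (∀ x → p x ≡ false) → anyB p xs ≡ false
anyB-false p []       p≡false = refl
anyB-false p (x ∷ xs) p≡false rewrite p≡false x = anyB-false p xs p≡false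

essentialB-true : ∀ {n} {f : BoolFun n} {k} → Extensional f →
  ∀ a → ∂ f k a ≡ true → essentialB f k ≡ true
essentialB-true {n} {f} {k} ext a ∂≡true =
  anyB-true (∂ f k) (Any.map (λ b≗a → trans (cong₂ _xor_ (ext b≗a) (ext (toggle-cong k b≗a))) ∂≡true)
                              (allAssign-complete n a))

essentialB-false : ∀ {n} {f : BoolFun n} {k} → (∀ a → ∂ f k a ≡ false) → essentialB f k ≡ false
essentialB-false {n} {f} {k} = anyB-false (∂ f k) (allAssign n)

count : ∀ {A : Set} → (A → Bool) → List A → ℕ
count p xs = length (filter (λ x → p x Bool.≟ true) xs)

count-tabulate-all : ∀ {A : Set} {n} (p : A → Bool) (h : Fin n → A) →
  (∀ k → p (h k) ≡ true) → count p (tabulate h) ≡ n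
count-tabulate-all {n = zero}  p h all = refl
count-tabulate-all {n = suc n} p h all rewrite all zero = cong suc (count-tabulate-all p (h ∘ suc) (all ∘ suc))

count-tabulate-all-but : ∀ {A : Set} {n} (p : A → Bool) (h : Fin n → A) (i : Fin n) →
  p (h i) ≡ false → (∀ k → k ≢ i → p (h k) ≡ true) → suc (count p (tabulate h)) ≡ n
count-tabulate-all-but p h zero    pᵢ others rewrite pᵢ =
  cong suc (count-tabulate-all p (h ∘ suc) (λ k → others (suc k) λ ()))
count-tabulate-all-but p h (suc i) pᵢ others rewrite others zero (λ ()) =
  cong suc (count-tabulate-all-but p (h ∘ suc) i pᵢ (λ k k≢i → others (suc k) (k≢i ∘ suc-injective)))

ess-all-essential : ∀ {n} (f : BoolFun n) → (∀ k → essentialB f k ≡ true) → ess f ≡ n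
ess-all-essential f = count-tabulate-all (essentialB f) id

ess-all-but-one : ∀ {n} (f : BoolFun n) i → essentialB f i ≡ false →
  (∀ k → k ≢ i → essentialB f k ≡ true) → suc (ess f) ≡ n
ess-all-but-one f = count-tabulate-all-but (essentialB f) id

-- Identification of variables

collapse : ∀ {n} → Fin n → Fin n → (Fin n → Bool) → Fin n → Bool
collapse i j a = set a i (a j)

collapse-cong : ∀ {n} (i j : Fin n) {a b} → a ≗ b → collapse i j a ≗ collapse i j b
collapse-cong i j a≗b m = cong₂ (λ u v → if does (m ≟ i) then u else v) (a≗b j) (a≗b m)

collapse-toggle-other : ∀ {n} {i j k : Fin n} (a : Fin n → Bool) → k ≢ i → k ≢ j →
  collapse i j (toggle a k) ≗ toggle (collapse i j a) k
collapse-toggle-other {i = i} {j} {k} a k≢i k≢j m with m ≟ i | m ≟ k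
... | yes refl | yes refl = ⊥-elim (k≢i refl)
... | yes refl | no _     = set-there a _ (k≢j ∘ sym)
... | no _     | yes refl = cong not (sym (set-there a _ k≢i))
... | no _     | no _     = refl

lin-collapse-false : ∀ {n} (l : Fin n → Bool) i j → lin l (collapse i j (λ _ → false)) ≡ false
lin-collapse-false l i j = trans (lin-cong l (λ m → if-eta (does (m ≟ i)))) (lin-false l)

lin-collapse-δ-other : ∀ {n} (l : Fin n → Bool) {i j m} → m ≢ i → m ≢ j →
  lin l (collapse i j (δ m)) ≡ l m
lin-collapse-δ-other l {i} {j} {m} m≢i m≢j = trans (lin-cong l collapse-δ) (lin-δ l m)
  where
  collapse-δ : collapse i j (δ m) ≗ δ m
  collapse-δ p with p ≟ i
  ... | yes refl = trans (δ-other (m≢j ∘ sym)) (sym (δ-other (m≢i ∘ sym)))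
  ... | no _     = refl

module _ {n} {i j : Fin n} (i≢j : i ≢ j) where

  collapse-toggle-source : ∀ a → collapse i j (toggle a i) ≗ collapse i j a
  collapse-toggle-source a m with m ≟ i
  ... | yes refl = set-there a _ (i≢j ∘ sym)
  ... | no _     = refl

  collapse-toggle-target : ∀ a → collapse i j (toggle a j) ≗ toggle (toggle (collapse i j a) j) i
  collapse-toggle-target a m with m ≟ i | m ≟ j
  ... | yes refl | yes refl = ⊥-elim (i≢j refl)
  ... | yes refl | no _     =
    trans (set-here a j _) (cong not (sym (trans (set-there (collapse i j a) _ i≢j) (set-here a i (a j)))))
  ... | no m≢i   | yes refl = cong not (sym (set-there a _ m≢i))
  ... | no _     | no _     = refl

  lin-collapse-δ-target : ∀ (l : Fin n → Bool) → lin l (collapse i j (δ j)) ≡ l i xor l j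
  lin-collapse-δ-target l = begin
    lin l (collapse i j (δ j))  ≡⟨ lin-cong l collapse-δ ⟩
    lin l (δ i ⊕δ j)            ≡⟨ lin-⊕δ l (δ i) j ⟩
    lin l (δ i) xor l j         ≡⟨ cong (_xor l j) (lin-δ l i) ⟩
    l i xor l j                 ∎
    where
    open ≡-Reasoning
    collapse-δ : collapse i j (δ j) ≗ δ i ⊕δ j
    collapse-δ p with p ≟ i
    ... | yes refl = trans (δ-self j) (sym (cong (true xor_) (δ-other i≢j)))
    ... | no _     = refl

identify-extensional : ∀ {n} {f : BoolFun n} → Extensional f → ∀ i j → Extensional (identify f i j)
identify-extensional ext i j a≗b = ext (collapse-cong i j a≗b)

module _ {n} {f : BoolFun n} (ext : Extensional f) {i j : Fin n} (a : Fin n → Bool) where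

  ∂-identify-source : i ≢ j → ∂ (identify f i j) i a ≡ false
  ∂-identify-source i≢j = trans (cong (identify f i j a xor_) (ext (collapse-toggle-source i≢j a)))
                                (xor-same (identify f i j a))

  ∂-identify-other : ∀ {k} → k ≢ i → k ≢ j → ∂ (identify f i j) k a ≡ ∂ f k (collapse i j a)
  ∂-identify-other k≢i k≢j = cong (identify f i j a xor_) (ext (collapse-toggle-other a k≢i k≢j))

  ∂-identify-target : i ≢ j →
    ∂ (identify f i j) j a ≡ ∂ f j (collapse i j a) xor ∂ f i (toggle (collapse i j a) j)
  ∂-identify-target i≢j = trans (cong (f y xor_) (ext (collapse-toggle-target i≢j a)))
                                (xor-telescope (f y) (f (toggle y j)) (f (toggle (toggle y j) i)))
    where y = collapse i j a

-- The function of a graph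

module _ {n} (G : Graph n) where

  upper : Fin n → Fin n → Bool
  upper i j = (toℕ i <ᵇ toℕ j) ∧ adj G i j

  fG-form : ∀ x → fG G x ≡ quad upper x xor lin (loop G) x
  fG-form x = cong₂ _xor_ quadratic (xorSum-allFin (λ i → loop G i ∧ x i))
    where
    open ≡-Reasoning
    entry : Fin n → Fin n → Bool
    entry i j = (toℕ i <ᵇ toℕ j) ∧ adj G i j ∧ x i ∧ x j
    row : Fin n → List Bool
    row i = map (entry i) (allFin n)
    quadratic : xorSum (concatMap row (allFin n)) ≡ quad upper x
    quadratic = begin
      xorSum (concat (map row (allFin n)))       ≡⟨ xorSum-concat (map row (allFin n)) ⟩
      xorSum (map xorSum (map row (allFin n)))   ≡⟨ cong xorSum (map-∘ (allFin n)) ⟨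
      xorSum (map (xorSum ∘ row) (allFin n))     ≡⟨ xorSum-allFin (xorSum ∘ row) ⟩
      ∑[ i < n ] xorSum (row i)
        ≡⟨ sum-cong-≗ (λ i → trans (xorSum-allFin (entry i))
                                     (sum-cong-≗ (λ j → sym (∧-assoc (toℕ i <ᵇ toℕ j) (adj G i j) (x i ∧ x j))))) ⟩
      quad upper x                               ∎

  fG-extensional : Extensional (fG G)
  fG-extensional {a} {b} a≗b =
    trans (fG-form a) (trans (cong₂ _xor_ (quad-cong upper a≗b) (lin-cong (loop G) a≗b)) (sym (fG-form b)))

  upper-xor-transpose : ∀ k m → upper m k xor upper k m ≡ adj G k m
  upper-xor-transpose k m with m ≟ k
  ... | yes refl rewrite adj-irr G m = cong₂ _xor_ (∧-zeroʳ (toℕ m <ᵇ toℕ m)) (∧-zeroʳ (toℕ m <ᵇ toℕ m))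
  ... | no m≢k rewrite adj-sym G m k =
    trans (sym (∧-distribʳ-xor (adj G k m) (toℕ m <ᵇ toℕ k) (toℕ k <ᵇ toℕ m)))
          (cong (_∧ adj G k m) (<ᵇ-xor->ᵇ (m≢k ∘ toℕ-injective)))

  upper-diagonal : ∀ k → upper k k ≡ false
  upper-diagonal k = trans (cong ((toℕ k <ᵇ toℕ k) ∧_) (adj-irr G k)) (∧-zeroʳ _)

  ∂-fG : ∀ k a → ∂ (fG G) k a ≡ loop G k xor lin (adj G k) a
  ∂-fG k a = begin
    fG G a xor fG G (toggle a k)
      ≡⟨ cong₂ _xor_ (fG-form a) (trans (fG-extensional (toggle-⊕δ a k)) (fG-form a′)) ⟩
    (quad upper a xor lin (loop G) a) xor (quad upper a′ xor lin (loop G) a′)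
      ≡⟨ xor-interchange (quad upper a) (lin (loop G) a) (quad upper a′) (lin (loop G) a′) ⟩
    (quad upper a xor quad upper a′) xor (lin (loop G) a xor lin (loop G) a′)
      ≡⟨ cong₂ _xor_ (∂-quad upper a k)
                     (trans (cong (lin (loop G) a xor_) (lin-⊕δ (loop G) a k))
                            (xor-cancelˡ (lin (loop G) a) (loop G k))) ⟩
    (lin (λ m → upper m k xor upper k m) a xor upper k k) xor loop G k
      ≡⟨ cong (_xor loop G k) (cong₂ _xor_ (sum-cong-≗ (λ m → cong (_∧ a m) (upper-xor-transpose k m)))
                                           (upper-diagonal k)) ⟩
    (lin (adj G k) a xor false) xor loop G k
      ≡⟨ trans (cong (_xor loop G k) (xor-identityʳ (lin (adj G k) a))) (xor-comm (lin (adj G k) a) (loop G k)) ⟩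
    loop G k xor lin (adj G k) a ∎
    where
    open ≡-Reasoning
    a′ = a ⊕δ k

  NeighboursWithin : Fin n → Fin n → Fin n → Set
  NeighboursWithin k p q = ∀ m → m ≢ p → m ≢ q → adj G k m ≡ false

  Satellite : Fin n → Fin n → Fin n → Set
  Satellite i j k = loop G k ≡ false × NeighboursWithin k i j × adj G k i ≡ adj G k j

  OppositeTwins : Fin n → Fin n → Set
  OppositeTwins i j = loop G i ≢ loop G j × (∀ m → m ≢ i → m ≢ j → adj G i m ≡ adj G j m)

  Obstructed : Fin n → Fin n → Set
  Obstructed i j = (∃[ k ] k ≢ i × k ≢ j × Satellite i j k) ⊎ OppositeTwins i j

  satellite? : ∀ i j k → Dec (Satellite i j k)
  satellite? i j k = (loop G k Bool.≟ false)
                 ×-dec all? (λ m → ¬? (m ≟ i) →-dec ¬? (m ≟ j) →-dec (adj G k m Bool.≟ false))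
                 ×-dec (adj G k i Bool.≟ adj G k j)

  oppositeTwins? : ∀ i j → Dec (OppositeTwins i j)
  oppositeTwins? i j = ¬? (loop G i Bool.≟ loop G j)
                   ×-dec all? (λ m → ¬? (m ≟ i) →-dec ¬? (m ≟ j) →-dec (adj G i m Bool.≟ adj G j m))

  obstructed? : ∀ i j → Dec (Obstructed i j)
  obstructed? i j = any? (λ k → ¬? (k ≟ i) ×-dec ¬? (k ≟ j) ×-dec satellite? i j k)
              ⊎-dec oppositeTwins? i j

  fG-essential : ∀ {k w} → adj G k w ≡ true → essentialB (fG G) k ≡ true
  fG-essential {k} {w} adjₖw with loop G k in loopₖ
  ... | true  = essentialB-true fG-extensional (λ _ → false)
                  (trans (∂-fG k _) (cong₂ _xor_ loopₖ (lin-false (adj G k))))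
  ... | false = essentialB-true fG-extensional (δ w)
                  (trans (∂-fG k _) (cong₂ _xor_ loopₖ (trans (lin-δ (adj G k) w) adjₖw)))

  module _ {i j : Fin n} (i≢j : i ≢ j) where

    private
      g : BoolFun n
      g = identify (fG G) i j

      g-witness : ∀ {k} a → ∂ g k a ≡ true → essentialB g k ≡ true
      g-witness = essentialB-true (identify-extensional fG-extensional i j)

      other-witness : ∀ {k} → k ≢ i → k ≢ j → ∀ a →
        loop G k xor lin (adj G k) (collapse i j a) ≡ true → essentialB g k ≡ true
      other-witness k≢i k≢j a ∂≡true =
        g-witness a (trans (∂-identify-other fG-extensional a k≢i k≢j) (trans (∂-fG _ _) ∂≡true))

      target-witness : adj G i j ≡ true → ∀ a →
        loop G i xor loop G j ≡ lin (adj G i) (collapse i j a) xor lin (adj G j) (collapse i j a) →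
        essentialB g j ≡ true
      target-witness adjᵢⱼ a loops≡lins = g-witness a (begin
        ∂ g j a
          ≡⟨ ∂-identify-target fG-extensional a i≢j ⟩
        ∂ (fG G) j y xor ∂ (fG G) i (toggle y j)
          ≡⟨ cong₂ _xor_ (∂-fG j y) (trans (∂-fG i (toggle y j)) (cong (loop G i xor_) lin-toggle)) ⟩
        (loop G j xor lin (adj G j) y) xor (loop G i xor (lin (adj G i) y xor true))
          ≡⟨ regroup (loop G i) (loop G j) (lin (adj G j) y) (lin (adj G i) y) true ⟩
        ((loop G i xor loop G j) xor (lin (adj G i) y xor lin (adj G j) y)) xor true
          ≡⟨ cong (λ b → (b xor (lin (adj G i) y xor lin (adj G j) y)) xor true) loops≡lins ⟩
        ((lin (adj G i) y xor lin (adj G j) y) xor (lin (adj G i) y xor lin (adj G j) y)) xor true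
          ≡⟨ cong (_xor true) (xor-same (lin (adj G i) y xor lin (adj G j) y)) ⟩
        true
          ∎)
        where
        open ≡-Reasoning
        y = collapse i j a
        lin-toggle : lin (adj G i) (toggle y j) ≡ lin (adj G i) y xor true
        lin-toggle = trans (lin-cong (adj G i) (toggle-⊕δ y j))
                           (trans (lin-⊕δ (adj G i) y j) (cong (lin (adj G i) y xor_) adjᵢⱼ))
        regroup : ∀ li lj u v t → (lj xor u) xor (li xor (v xor t)) ≡ ((li xor lj) xor (v xor u)) xor t
        regroup = solve 5 (λ li lj u v t → (lj ⊕ u) ⊕ (li ⊕ (v ⊕ t)) ⊜ ((li ⊕ lj) ⊕ (v ⊕ u)) ⊕ t) refl

    identify-essential-other : ∀ {k} → k ≢ i → k ≢ j → ¬ Satellite i j k → essentialB g k ≡ true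
    identify-essential-other {k} k≢i k≢j ¬sat with loop G k in loopₖ
    ... | true = other-witness k≢i k≢j (λ _ → false) (cong₂ _xor_ loopₖ (lin-collapse-false (adj G k) i j))
    ... | false with any? (λ m → ¬? (m ≟ i) ×-dec ¬? (m ≟ j) ×-dec (adj G k m Bool.≟ true))
    ...   | yes (m , m≢i , m≢j , adjₖₘ) =
      other-witness k≢i k≢j (δ m)
        (cong₂ _xor_ loopₖ (trans (lin-collapse-δ-other (adj G k) m≢i m≢j) adjₖₘ))
    ...   | no ∄m with adj G k i Bool.≟ adj G k j
    ...     | no adjₖᵢ≢adjₖⱼ =
      other-witness k≢i k≢j (δ j)
        (cong₂ _xor_ loopₖ (trans (lin-collapse-δ-target i≢j (adj G k)) (xor-≢ adjₖᵢ≢adjₖⱼ)))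
    ...     | yes adjₖᵢ≡adjₖⱼ =
      ⊥-elim (¬sat (refl , (λ m m≢i m≢j → ¬-not (λ adjₖₘ → ∄m (m , m≢i , m≢j , adjₖₘ))) , adjₖᵢ≡adjₖⱼ))

    identify-essential-target : adj G i j ≡ true → ¬ OppositeTwins i j → essentialB g j ≡ true
    identify-essential-target adjᵢⱼ ¬twins with loop G i Bool.≟ loop G j
    ... | yes loopᵢ≡loopⱼ = target-witness adjᵢⱼ (λ _ → false)
      (trans (trans (cong (_xor loop G j) loopᵢ≡loopⱼ) (xor-same (loop G j)))
             (sym (cong₂ _xor_ (lin-collapse-false (adj G i) i j) (lin-collapse-false (adj G j) i j))))
    ... | no loopᵢ≢loopⱼ with any? (λ m → ¬? (m ≟ i) ×-dec ¬? (m ≟ j) ×-dec ¬? (adj G i m Bool.≟ adj G j m))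
    ...   | yes (m , m≢i , m≢j , adjᵢₘ≢adjⱼₘ) = target-witness adjᵢⱼ (δ m)
      (trans (xor-≢ loopᵢ≢loopⱼ) (sym (trans (cong₂ _xor_ (lin-collapse-δ-other (adj G i) m≢i m≢j)
                                                           (lin-collapse-δ-other (adj G j) m≢i m≢j))
                                             (xor-≢ adjᵢₘ≢adjⱼₘ))))
    ...   | no ∄m = ⊥-elim (¬twins (loopᵢ≢loopⱼ , λ m m≢i m≢j →
                      decidable-stable (adj G i m Bool.≟ adj G j m) (λ ≢ → ∄m (m , m≢i , m≢j , ≢))))

    ess-identify-unobstructed : (∀ k → ∃[ w ] adj G k w ≡ true) → adj G i j ≡ true → ¬ Obstructed i j →
      suc (ess g) ≡ ess (fG G)
    ess-identify-unobstructed neighbour adjᵢⱼ ¬obstructed =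
      trans (ess-all-but-one g i (essentialB-false {f = g} (λ a → ∂-identify-source fG-extensional a i≢j))
                             essential-off-i)
            (sym (ess-all-essential (fG G) (λ k → fG-essential (proj₂ (neighbour k)))))
      where
      essential-off-i : ∀ k → k ≢ i → essentialB g k ≡ true
      essential-off-i k k≢i with k ≟ j
      ... | yes refl = identify-essential-target adjᵢⱼ (¬obstructed ∘ inj₂)
      ... | no k≢j   = identify-essential-other k≢i k≢j (λ sat → ¬obstructed (inj₁ (k , k≢i , k≢j , sat)))

  -- Graphs whose edges are all obstructed

  adjacent⇒≢ : ∀ {x y} → adj G x y ≡ true → x ≢ y
  adjacent⇒≢ {x} adjₓₓ refl = true≢false (trans (sym adjₓₓ) (adj-irr G x))

  Closed : (Fin n → Set) → Set
  Closed P = ∀ {x y} → adj G x y ≡ true → P x → P y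

  Clique : (Fin n → Set) → Set
  Clique P = ∀ {x y} → P x → P y → x ≢ y → adj G x y ≡ true

  Complete : Set
  Complete = ∀ a b → a ≢ b → adj G a b ≡ true

  reach-closed : ∀ {P} → Closed P → ∀ {u v} → Reach G u v → P u → P v
  reach-closed closed here             Pu = Pu
  reach-closed closed (step adjᵤᵥ path) Pu = reach-closed closed path (closed adjᵤᵥ Pu)

  closed-clique⇒complete : Connected G → ∀ {P u} → Closed P → Clique P → P u → Complete
  closed-clique⇒complete connected {u = u} closed clique Pu a b =
    clique (reach-closed closed (connected u a) Pu) (reach-closed closed (connected u b) Pu)

  reach-first-step : ∀ {u v} → u ≢ v → Reach G u v → ∃[ w ] adj G u w ≡ true
  reach-first-step u≢u here                   = ⊥-elim (u≢u refl)
  reach-first-step _   (step {v = w} adjᵤw _) = w , adjᵤw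

  has-neighbour : Connected G → ∀ {a b} → a ≢ b → ∀ k → ∃[ w ] adj G k w ≡ true
  has-neighbour connected {a} {b} a≢b k with k ≟ a
  ... | yes refl = reach-first-step a≢b (connected k b)
  ... | no k≢a   = reach-first-step k≢a (connected k a)

  opposite-twins⇒complete : Connected G → (∀ x y → adj G x y ≡ true → OppositeTwins x y) → Complete
  opposite-twins⇒complete connected twins a b a≢b with connected a b
  ... | here = ⊥-elim (a≢b refl)
  ... | step {v = c} adjₐc _ with any? (λ s → ¬? (s ≟ a) ×-dec ¬? (s ≟ c) ×-dec (adj G a s Bool.≟ true))
  ...   | yes (s , s≢a , s≢c , adjₐₛ) =
    ⊥-elim (no-three-distinct-bools (proj₁ (twins a c adjₐc)) (proj₁ (twins a s adjₐₛ))
                                    (proj₁ (twins c s (trans (sym (proj₂ (twins a c adjₐc) s s≢a s≢c)) adjₐₛ))))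
  ...   | no ∄s = closed-clique⇒complete connected {P = Edge} closed clique (inj₁ refl) a b a≢b
    where
    Edge : Fin n → Set
    Edge x = x ≡ a ⊎ x ≡ c

    closed : Closed Edge
    closed {x} {y} adjₓᵧ Ex with y ≟ a | y ≟ c
    ... | yes y≡a | _       = inj₁ y≡a
    ... | no _    | yes y≡c = inj₂ y≡c
    ... | no y≢a  | no y≢c  = ⊥-elim (∄s (y , y≢a , y≢c , adjₐᵧ Ex))
      where
      adjₐᵧ : Edge x → adj G a y ≡ true
      adjₐᵧ (inj₁ refl) = adjₓᵧ
      adjₐᵧ (inj₂ refl) = trans (proj₂ (twins a c adjₐc) y y≢a y≢c) adjₓᵧ

    clique : Clique Edge
    clique (inj₁ refl) (inj₁ refl) x≢y = ⊥-elim (x≢y refl)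
    clique (inj₁ refl) (inj₂ refl) _   = adjₐc
    clique (inj₂ refl) (inj₁ refl) _   = trans (adj-sym G c a) adjₐc
    clique (inj₂ refl) (inj₂ refl) x≢y = ⊥-elim (x≢y refl)

  module _ (neighbour : ∀ k → ∃[ w ] adj G k w ≡ true) where

    satellite-adjacent : ∀ {i j k} → Satellite i j k → adj G k i ≡ true × adj G k j ≡ true
    satellite-adjacent {i} {j} {k} (_ , within , adjₖᵢ≡adjₖⱼ) with neighbour k
    ... | w , adjₖw with w ≟ i | w ≟ j
    ...   | yes refl | _        = adjₖw , trans (sym adjₖᵢ≡adjₖⱼ) adjₖw
    ...   | no _     | yes refl = trans adjₖᵢ≡adjₖⱼ adjₖw , adjₖw
    ...   | no w≢i   | no w≢j   = ⊥-elim (true≢false (trans (sym adjₖw) (within w w≢i w≢j)))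

    module _ (obstructed : ∀ x y → adj G x y ≡ true → Obstructed x y) where

      -- A satellite of the edge {i, k} is adjacent to k, so it can only be j.
      satellite-confines : ∀ {i j k} → Satellite i j k →
        (loop G j ≡ false × NeighboursWithin j i k) ⊎ (loop G i ≡ true × NeighboursWithin i j k)
      satellite-confines {i} {j} {k} sat@(loopₖ , withinₖ , _)
        with obstructed i k (trans (adj-sym G i k) (proj₁ (satellite-adjacent sat)))
      ... | inj₁ (k′ , k′≢i , k′≢k , sat′@(loopₖ′ , withinₖ′ , _)) with k′ ≟ j
      ...   | yes refl = inj₁ (loopₖ′ , withinₖ′)
      ...   | no k′≢j  = ⊥-elim (true≢false (trans (sym adjₖₖ′) (withinₖ k′ k′≢i k′≢j)))
        where adjₖₖ′ = trans (adj-sym G k k′) (proj₂ (satellite-adjacent sat′))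
      satellite-confines {i} {j} {k} (loopₖ , withinₖ , _) | inj₂ (loopᵢ≢loopₖ , twin) =
        inj₂ (trans (¬-not loopᵢ≢loopₖ) (cong not loopₖ) , within)
        where
        within : NeighboursWithin i j k
        within m m≢j m≢k with m ≟ i
        ... | yes refl = adj-irr G m
        ... | no m≢i   = trans (twin m m≢i m≢k) (withinₖ m m≢i m≢j)

      satellite-swap : ∀ {i j k} → Satellite i j k → Satellite j i k
      satellite-swap (loopₖ , within , adjₖᵢ≡adjₖⱼ) =
        loopₖ , (λ m m≢j m≢i → within m m≢i m≢j) , sym adjₖᵢ≡adjₖⱼ

      satellite⇒complete : Connected G → ∀ {i j k} → adj G i j ≡ true → Satellite i j k → Complete
      satellite⇒complete connected {i} {j} {k} adjᵢⱼ sat@(_ , withinₖ , _) =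
        closed-clique⇒complete connected {P = Triangle} closed clique (inj₁ refl)
        where
        Triangle : Fin n → Set
        Triangle x = x ≡ i ⊎ x ≡ j ⊎ x ≡ k

        adjₖᵢ = proj₁ (satellite-adjacent sat)
        adjₖⱼ = proj₂ (satellite-adjacent sat)

        within-ij : NeighboursWithin i j k × NeighboursWithin j i k
        within-ij with satellite-confines sat | satellite-confines (satellite-swap sat)
        ... | inj₁ (_ , withinⱼ)  | inj₁ (_ , withinᵢ)  = withinᵢ , withinⱼ
        ... | inj₁ (loopⱼ , _)    | inj₂ (loopⱼ′ , _)   = ⊥-elim (true≢false (trans (sym loopⱼ′) loopⱼ))
        ... | inj₂ (loopᵢ , _)    | inj₁ (loopᵢ′ , _)   = ⊥-elim (true≢false (trans (sym loopᵢ) loopᵢ′))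
        ... | inj₂ (_ , withinᵢ)  | inj₂ (_ , withinⱼ)  = withinᵢ , withinⱼ

        closed : Closed Triangle
        closed {x} {y} adjₓᵧ Tx with y ≟ i | y ≟ j | y ≟ k
        ... | yes y≡i | _       | _       = inj₁ y≡i
        ... | no _    | yes y≡j | _       = inj₂ (inj₁ y≡j)
        ... | no _    | no _    | yes y≡k = inj₂ (inj₂ y≡k)
        ... | no y≢i  | no y≢j  | no y≢k  = ⊥-elim (true≢false (trans (sym adjₓᵧ) (outside Tx)))
          where
          outside : Triangle x → adj G x y ≡ false
          outside (inj₁ refl)        = proj₁ within-ij y y≢j y≢k
          outside (inj₂ (inj₁ refl)) = proj₂ within-ij y y≢i y≢k
          outside (inj₂ (inj₂ refl)) = withinₖ y y≢i y≢j

        clique : Clique Triangle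
        clique (inj₁ refl)        (inj₁ refl)        x≢y = ⊥-elim (x≢y refl)
        clique (inj₁ refl)        (inj₂ (inj₁ refl)) _   = adjᵢⱼ
        clique (inj₁ refl)        (inj₂ (inj₂ refl)) _   = trans (adj-sym G i k) adjₖᵢ
        clique (inj₂ (inj₁ refl)) (inj₁ refl)        _   = trans (adj-sym G j i) adjᵢⱼ
        clique (inj₂ (inj₁ refl)) (inj₂ (inj₁ refl)) x≢y = ⊥-elim (x≢y refl)
        clique (inj₂ (inj₁ refl)) (inj₂ (inj₂ refl)) _   = trans (adj-sym G j k) adjₖⱼ
        clique (inj₂ (inj₂ refl)) (inj₁ refl)        _   = adjₖᵢ
        clique (inj₂ (inj₂ refl)) (inj₂ (inj₁ refl)) _   = adjₖⱼ
        clique (inj₂ (inj₂ refl)) (inj₂ (inj₂ refl)) x≢y = ⊥-elim (x≢y refl)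

      obstructed⇒complete : Connected G → Complete
      obstructed⇒complete connected
        with any? (λ i → any? (λ j → (adj G i j Bool.≟ true) ×-dec any? (satellite? i j)))
      ... | yes (i , j , adjᵢⱼ , k , sat) = satellite⇒complete connected adjᵢⱼ sat
      ... | no ∄satellite = opposite-twins⇒complete connected twins
        where
        twins : ∀ x y → adj G x y ≡ true → OppositeTwins x y
        twins x y adjₓᵧ with obstructed x y adjₓᵧ
        ... | inj₁ (k , _ , _ , sat) = ⊥-elim (∄satellite (x , y , adjₓᵧ , k , sat))
        ... | inj₂ oppositeTwins     = oppositeTwins

lemma4p10 : (n : ℕ) (G : Graph n) → Connected G →
    (i j : Fin n) → ¬ (i ≡ j) → adj G i j ≡ false →
    suc (ess (identify (fG G) i j)) ≡ ess (fG G) →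
    Σ (Fin n) λ i′ → Σ (Fin n) λ j′ →
    ¬ (i′ ≡ j′) × adj G i′ j′ ≡ true ×
    suc (ess (identify (fG G) i′ j′)) ≡ ess (fG G)
lemma4p10 n G connected i j i≢j nonadjacent _
  with any? (λ i′ → any? (λ j′ → (adj G i′ j′ Bool.≟ true) ×-dec ¬? (obstructed? G i′ j′)))
... | yes (i′ , j′ , adjacent , ¬obstructed) =
  i′ , j′ , adjacent⇒≢ G adjacent , adjacent ,
  ess-identify-unobstructed G (adjacent⇒≢ G adjacent) (has-neighbour G connected i≢j) adjacent ¬obstructed
... | no ∄unobstructed = ⊥-elim (true≢false (trans (sym complete) nonadjacent))
  where
  obstructed : ∀ x y → adj G x y ≡ true → Obstructed G x y
  obstructed x y adjₓᵧ =
    decidable-stable (obstructed? G x y) (λ ¬obs → ∄unobstructed (x , y , adjₓᵧ , ¬obs))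
  complete : adj G i j ≡ true
  complete = obstructed⇒complete G (has-neighbour G connected i≢j) obstructed connected i j i≢j
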